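{- Let $\varepsilon=1/100$, let $\lambda\vdash n$ and let $\lambda^+=(\lambda_1,\dots,\lambda_p)$ be the parts of $\lambda$ greater than $n^{1-\varepsilon}$, $\lambda^-$ the remaining parts. Then: (i) $\displaystyle\frac1{n!}f_\lambda^2\le\frac{n!}{\prod_{i=1}^p(\lambda_i!)^2\,((n-|\lambda^+|)!)^2}f_{\lambda^- }^2\le\frac{n!}{\prod_{i=1}^p(\lambda_i!)^2\,(n-|\lambda^+|)!}\le\frac{n^{|\lambda^+|}}{\prod_{i=1}^p(\lambda_i!)^2}$; (ii) $C_\lambda\le\lambda_1n/2$; (iii) $C_\lambda=C_{\lambda^+}-p|\lambda^-|+C_{\lambda^- }=\sum_{i=1}^p\frac{\lambda_i(\lambda_i-2i+1)}2-p|\lambda^-|+C_{\lambda^- }$.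
   Context: For a partition $\mu$, $|\mu|$ is its size, $f_\mu$ the number of standard Young tableaux of shape $\mu$ ($f_\emptyset=1$), and $C_\mu=\sum_{(i,j)\in\mu}(j-i)=\sum_i\mu_i(\mu_i-2i+1)/2$ its content-sum. -}

module Defs where

open import Data.Nat using (ℕ; zero; suc; _+_; _*_; _∸_; _^_; _<_; _≥_; _<ᵇ_; _!)
open import Data.Nat.ListAction using (sum; product)

open import Data.Bool using (if_then_else_)
open import Data.List using (List; []; _∷_; _++_; map; filter)
open import Data.List.Relation.Unary.All using (All)
open import Data.List.Relation.Unary.Linked using (Linked)
open import Data.Integer as ℤ using (ℤ; +_)
open import Relation.Binary.PropositionalEquality using (_≡_)

record IsPartition (n : ℕ) (λs : List ℕ) : Set where
  field
    decreasing : Linked _≥_ λs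
    positive   : All (λ x → 0 < x) λs
    size       : sum λs ≡ n

∣_∣ₚ : List ℕ → ℕ
∣ μ ∣ₚ = sum μ

first : List ℕ → ℕ
first []      = 0
first (x ∷ _) = x

shrinkRow : ℕ → List ℕ → List ℕ
shrinkRow (suc zero) xs = xs
shrinkRow x          xs = (x ∸ 1) ∷ xs

-- All shapes obtained from μ by removing one removable corner cell
-- (row i is removable iff μ_i > μ_{i+1}).
removals : List ℕ → List (List ℕ)
removals []       = []
removals (x ∷ xs) =
  (if first xs <ᵇ x then shrinkRow x xs ∷ [] else [])
  ++ map (x ∷_) (removals xs)

-- Number of chains  ∅ = μ⁰ ⊂ μ¹ ⊂ … ⊂ μᵏ = μ  in Young's lattice, each step
-- adding one cell (counted from the top, by removing the cell holding the
-- largest entry); i.e. the number of standard Young tableaux of shape μ.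
sytChains : ℕ → List ℕ → ℕ
sytChains zero    []      = 1
sytChains zero    (_ ∷ _) = 0
sytChains (suc k) μ       = sum (map (sytChains k) (removals μ))

f : List ℕ → ℕ
f μ = sytChains ∣ μ ∣ₚ μ

-- Content sum over the cells of row i (1-indexed) of length x : Σ_{j=1}^{x} (j - i)
rowContent : ℕ → ℕ → ℤ
rowContent i zero    = + 0
rowContent i (suc j) = rowContent i j ℤ.+ (+ suc j ℤ.- + i)

contentFrom : ℕ → List ℕ → ℤ
contentFrom i []       = + 0
contentFrom i (x ∷ xs) = rowContent i x ℤ.+ contentFrom (suc i) xs

C : List ℕ → ℤ
C μ = contentFrom 1 μ

Σℤ : List ℤ → ℤ
Σℤ []       = + 0
Σℤ (x ∷ xs) = x ℤ.+ Σℤ xs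

-- ε = 1/100:  part x is "large" iff x > n^(1-ε) = n^(99/100)  iff  x^100 > n^99
λ⁺ : ℕ → List ℕ → List ℕ
λ⁺ n λs = filter (λ x → Data.Nat._<?_ (n ^ 99) (x ^ 100)) λs
  where import Data.Nat

λ⁻ : ℕ → List ℕ → List ℕ
λ⁻ n λs = filter (λ x → Data.Nat._≤?_ (x ^ 100) (n ^ 99)) λs
  where import Data.Nat

{-# OPTIONS --safe #-}

-- (i) A standard tableau of shape λ is determined by the entries of its large rows
-- λ₁, …, λ_p and a standard tableau of shape λ⁻, so f_λ ≤ n! / (∏ λ_i! · |λ⁻|!) · f_{λ⁻};
-- this is proved one row at a time, f(x ∷ ν) ≤ C(x + |ν|, x) · f(ν), by Pascal's rule.
-- The bound f_μ² ≤ |μ|! holds because Young's lattice is 1-differential: the operators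
-- (D g)(μ) = Σ_{ρ ⋖ μ} g(ρ) and (U g)(μ) = Σ_{ν ⋗ μ} g(ν) satisfy U D = 1 + D U, so
-- (U^k D^k δ_∅)(∅) = k!, and since U and D are adjoint this number is Σ_{|μ| = k} f_μ².
-- Finally n! / (n − m)! ≤ n^m.
-- (ii) and (iii) follow from 2 Σ_{j ≤ x} (j − i) = x (x − 2i + 1) for a row i of length x,
-- and from the fact that moving a block of rows p rows down lowers its content by p times its size.

module Submission where

open import Defs
open import Data.Bool using (Bool; true; false; T; if_then_else_)
open import Data.Empty using (⊥-elim)
open import Data.List using (List; []; _∷_; _++_; map; filter; length; zipWith; applyUpTo)
open import Data.List.Properties using (map-∘; map-cong; map-cong-local; filter-accept; filter-reject; filter-all; filter-none)
open import Data.List.Relation.Unary.All as All using (All; []; _∷_)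
open import Data.List.Relation.Unary.All.Properties using (++⁺; map⁺)
open import Data.List.Relation.Unary.Linked as Linked using (Linked; []; [-]; _∷_)
open import Data.List.Relation.Unary.Linked.Properties using (Linked⇒All)
open import Data.Nat as ℕ
  using (ℕ; zero; suc; _+_; _*_; _∸_; _/_; _^_; _≤_; _<_; _≥_; z≤n; s≤s; s≤s⁻¹; s<s⁻¹; _<ᵇ_; _<?_; _≤?_; _!)
open import Data.Nat.Combinatorics using (nCk≡n!/k![n-k]!; k![n∸k]!∣n!; nCn≡1; nCk+nC[k+1]≡[n+1]C[k+1])
  renaming (_C_ to _choose_)
open import Data.Nat.DivMod using (m/n*n≡m; m*n/n≡m; m*n%n≡0)
open import Data.Nat.ListAction using (sum; product)
open import Data.Nat.ListAction.Properties using (sum-++)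
open import Data.Nat.Properties
open import Data.Nat.Tactic.RingSolver using (solve-∀)
open import Data.Product using (_×_; _,_)
open import Data.Sum using (inj₁; inj₂)
open import Data.Unit using (⊤; tt)
open import Function using (_∘_)
open import Relation.Nullary using (yes; no; does)
open import Relation.Nullary.Decidable using (dec-true; dec-false)
open import Relation.Binary.PropositionalEquality
open import Algebra.Properties.CommutativeSemigroup +-commutativeSemigroup using ()
  renaming (interchange to +-interchange)
open import Algebra.Properties.CommutativeSemigroup *-commutativeSemigroup using ()
  renaming (interchange to *-interchange)

<ᵇ≡true⇒< : ∀ {m n} → (m <ᵇ n) ≡ true → m < n
<ᵇ≡true⇒< {m} {n} eq = <ᵇ⇒< m n (subst T (sym eq) tt)

<⇒<ᵇ≡true : ∀ {m n} → m < n → (m <ᵇ n) ≡ true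
<⇒<ᵇ≡true {m} {n} m<n with m <ᵇ n | <⇒<ᵇ m<n
... | true | _ = refl

<ᵇ≡false⇒≥ : ∀ {m n} → (m <ᵇ n) ≡ false → n ≤ m
<ᵇ≡false⇒≥ eq = ≮⇒≥ (λ m<n → subst T eq (<⇒<ᵇ m<n))

≥⇒<ᵇ≡false : ∀ {m n} → n ≤ m → (m <ᵇ n) ≡ false
≥⇒<ᵇ≡false {m} {n} n≤m with m <ᵇ n in eq
... | true  = ⊥-elim (<⇒≱ (<ᵇ≡true⇒< eq) n≤m)
... | false = refl

private
  variable
    A B : Set

∑ : List A → (A → ℕ) → ℕ
∑ L g = sum (map g L)

∑-cong : ∀ {g h : A → ℕ} L → (∀ a → g a ≡ h a) → ∑ L g ≡ ∑ L h
∑-cong L g≗h = cong sum (map-cong g≗h L)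

∑-cong-All : ∀ {g h : A → ℕ} {L} → All (λ a → g a ≡ h a) L → ∑ L g ≡ ∑ L h
∑-cong-All eqs = cong sum (map-cong-local eqs)

∑-mono-All : ∀ {g h : A → ℕ} {L} → All (λ a → g a ≤ h a) L → ∑ L g ≤ ∑ L h
∑-mono-All []         = z≤n
∑-mono-All (le ∷ les) = +-mono-≤ le (∑-mono-All les)

∑-mono : ∀ {g h : A → ℕ} L → (∀ a → g a ≤ h a) → ∑ L g ≤ ∑ L h
∑-mono L g≤h = ∑-mono-All (All.universal g≤h L)

∑-map : ∀ (f : B → A) (g : A → ℕ) L → ∑ (map f L) g ≡ ∑ L (g ∘ f)
∑-map f g L = cong sum (sym (map-∘ L))

∑-zero : ∀ (L : List A) → ∑ L (λ _ → 0) ≡ 0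
∑-zero []      = refl
∑-zero (_ ∷ L) = ∑-zero L

∑-vanishes : ∀ {g : A → ℕ} L → (∀ a → g a ≡ 0) → ∑ L g ≡ 0
∑-vanishes L g≡0 = trans (∑-cong L g≡0) (∑-zero L)

∑-+ : ∀ (g h : A → ℕ) L → ∑ L (λ a → g a + h a) ≡ ∑ L g + ∑ L h
∑-+ g h []      = refl
∑-+ g h (a ∷ L) = trans (cong (g a + h a +_) (∑-+ g h L)) (+-interchange (g a) (h a) (∑ L g) (∑ L h))

∑-*ˡ : ∀ c (g : A → ℕ) L → ∑ L (λ a → c * g a) ≡ c * ∑ L g
∑-*ˡ c g []      = sym (*-zeroʳ c)
∑-*ˡ c g (a ∷ L) = trans (cong (c * g a +_) (∑-*ˡ c g L)) (sym (*-distribˡ-+ c (g a) _))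

∑-if : ∀ b (g : A → ℕ) L → ∑ L (λ a → if b then g a else 0) ≡ (if b then ∑ L g else 0)
∑-if true  g L = refl
∑-if false g L = ∑-zero L

∑-comm : ∀ (F : A → B → ℕ) L M → ∑ L (λ a → ∑ M (F a)) ≡ ∑ M (λ b → ∑ L (λ a → F a b))
∑-comm F []      M = sym (∑-zero M)
∑-comm F (a ∷ L) M = trans (cong (∑ M (F a) +_) (∑-comm F L M)) (sym (∑-+ (F a) _ M))

∑-if-const : ∀ (p : A → Bool) b (g : A → ℕ) {L} → All (λ a → p a ≡ b) L →
             ∑ L (λ a → if p a then g a else 0) ≡ (if b then ∑ L g else 0)
∑-if-const p b g {L} eqs =
  trans (∑-cong-All (All.map (cong (λ c → if c then _ else 0)) eqs)) (∑-if b g L)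

All-if : ∀ {P : A → Set} b {a} → (b ≡ true → P a) → All P (if b then a ∷ [] else [])
All-if true  Pa = Pa refl ∷ []
All-if false _  = []

-- Shapes, and the cells that can be removed from or added to them

IsShape : List ℕ → Set
IsShape []       = ⊤
IsShape (x ∷ xs) = first xs ≤ x × 0 < x × IsShape xs

first<1⇒≡[] : ∀ {xs} → IsShape xs → first xs < 1 → xs ≡ []
first<1⇒≡[] {[]}         _           _       = refl
first<1⇒≡[] {zero ∷ _}   (_ , () , _) _
first<1⇒≡[] {suc _ ∷ _}  _           (s≤s ())

Linked⇒IsShape : ∀ {xs} → Linked _≥_ xs → All (0 <_) xs → IsShape xs
Linked⇒IsShape []          []       = tt
Linked⇒IsShape [-]         (p ∷ []) = z≤n , p , tt
Linked⇒IsShape (y≤x ∷ lk)  (p ∷ ps) = y≤x , p , Linked⇒IsShape lk ps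

IsShape-++ʳ : ∀ A {B} → IsShape (A ++ B) → IsShape B
IsShape-++ʳ []      s           = s
IsShape-++ʳ (_ ∷ A) (_ , _ , s) = IsShape-++ʳ A s

≤first : ∀ {xs} → Linked _≥_ xs → All (_≤ first xs) xs
≤first {[]}    _  = []
≤first {_ ∷ _} lk = Linked⇒All (λ z≤y y≤x → ≤-trans y≤x z≤y) ≤-refl lk

first-map-∷ : ∀ x L → All (λ ν → first ν ≡ x) (map (x ∷_) L)
first-map-∷ x L = map⁺ (All.universal (λ _ → refl) L)

map-∷-IsShape : ∀ {x c L} → c ≤ x → 0 < x →
                All (λ ρ → first ρ ≤ c × IsShape ρ) L → All IsShape (map (x ∷_) L)
map-∷-IsShape c≤x 0<x = map⁺ ∘ All.map (λ (ρ≤c , ρ-shape) → ≤-trans ρ≤c c≤x , 0<x , ρ-shape)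

first-shrinkRow : ∀ x xs → first xs < x → first (shrinkRow x xs) < x
first-shrinkRow (suc zero)    xs xs<x = xs<x
first-shrinkRow (suc (suc k)) xs _    = ≤-refl

shrinkRow-IsShape : ∀ x xs → first xs < x → IsShape xs → IsShape (shrinkRow x xs)
shrinkRow-IsShape (suc zero)    xs _          s = s
shrinkRow-IsShape (suc (suc k)) xs (s≤s xs≤k) s = xs≤k , s≤s z≤n , s

removals-first : ∀ μ → All (λ ν → first ν ≤ first μ) (removals μ)
removals-first []       = []
removals-first (x ∷ xs) =
  ++⁺ (All-if (first xs <ᵇ x) (<⇒≤ ∘ first-shrinkRow x xs ∘ <ᵇ≡true⇒<))
      (All.map ≤-reflexive (first-map-∷ x (removals xs)))

removals-IsShape : ∀ μ → IsShape μ → All IsShape (removals μ)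
removals-IsShape []       _                 = []
removals-IsShape (x ∷ xs) (xs≤x , 0<x , s) =
  ++⁺ (All-if (first xs <ᵇ x) (λ eq → shrinkRow-IsShape x xs (<ᵇ≡true⇒< eq) s))
      (map-∷-IsShape xs≤x 0<x (All.zip (removals-first xs , removals-IsShape xs s)))

sum-shrinkRow : ∀ x xs → first xs < x → suc (sum (shrinkRow x xs)) ≡ x + sum xs
sum-shrinkRow (suc zero)    xs _ = refl
sum-shrinkRow (suc (suc k)) xs _ = refl

removals-size : ∀ μ → All (λ ν → suc (sum ν) ≡ sum μ) (removals μ)
removals-size []       = []
removals-size (x ∷ xs) =
  ++⁺ (All-if (first xs <ᵇ x) (sum-shrinkRow x xs ∘ <ᵇ≡true⇒<))
      (map⁺ (All.map (λ {ρ} e → trans (sym (+-suc x (sum ρ))) (cong (x +_) e)) (removals-size xs)))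

addFirstRow : List ℕ → List ℕ
addFirstRow []       = 1 ∷ []
addFirstRow (y ∷ ys) = suc y ∷ ys

mutual
  additions : List ℕ → List (List ℕ)
  additions μ = addFirstRow μ ∷ addLowerRows μ

  addLowerRows : List ℕ → List (List ℕ)
  addLowerRows []       = []
  addLowerRows (y ∷ ys) = map (y ∷_) (additionsBelow y ys)

  additionsBelow : ℕ → List ℕ → List (List ℕ)
  additionsBelow y ys = if first ys <ᵇ y then additions ys else addLowerRows ys

first-addFirstRow : ∀ xs → first (addFirstRow xs) ≡ suc (first xs)
first-addFirstRow []      = refl
first-addFirstRow (_ ∷ _) = refl

addLowerRows-first : ∀ xs → All (λ ν → first ν ≡ first xs) (addLowerRows xs)
addLowerRows-first []       = []
addLowerRows-first (y ∷ ys) = first-map-∷ y (additionsBelow y ys)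

addFirstRow-IsShape : ∀ μ → IsShape μ → IsShape (addFirstRow μ)
addFirstRow-IsShape []       _                      = z≤n , s≤s z≤n , tt
addFirstRow-IsShape (x ∷ xs) (xs≤x , _ , xs-shape) = m≤n⇒m≤1+n xs≤x , s≤s z≤n , xs-shape

additionsBelow-All : ∀ {P : List ℕ → Set} y ys → ((first ys <ᵇ y) ≡ true → P (addFirstRow ys)) →
                     All P (addLowerRows ys) → All P (additionsBelow y ys)
additionsBelow-All y ys P-first P-lower with first ys <ᵇ y
... | true  = P-first refl ∷ P-lower
... | false = P-lower

addLowerRows-IsShape : ∀ μ → IsShape μ → All IsShape (addLowerRows μ)
addLowerRows-IsShape []       _                 = []
addLowerRows-IsShape (y ∷ ys) (ys≤y , 0<y , s) = map-∷-IsShape ≤-refl 0<y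
  (additionsBelow-All y ys (λ eq → first-addFirstRow≤y eq , addFirstRow-IsShape ys s)
     (All.zip (All.map (λ e → subst (_≤ y) (sym e) ys≤y) (addLowerRows-first ys) , addLowerRows-IsShape ys s)))
  where
  first-addFirstRow≤y : (first ys <ᵇ y) ≡ true → first (addFirstRow ys) ≤ y
  first-addFirstRow≤y eq = subst (_≤ y) (sym (first-addFirstRow ys)) (<ᵇ≡true⇒< eq)

additions-IsShape : ∀ μ → IsShape μ → All IsShape (additions μ)
additions-IsShape μ s = addFirstRow-IsShape μ s ∷ addLowerRows-IsShape μ s

-- The down and up operators of Young's lattice

down up : (List ℕ → ℕ) → List ℕ → ℕ
down g μ = ∑ (removals μ) g
up   g μ = ∑ (additions μ) g

upBelow : ℕ → (List ℕ → ℕ) → List ℕ → ℕ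
upBelow x g ν = ∑ (additionsBelow x ν) g

down-∷ : ∀ g x xs →
         down g (x ∷ xs) ≡ (if first xs <ᵇ x then g (shrinkRow x xs) else 0) + down (g ∘ (x ∷_)) xs
down-∷ g x xs with first xs <ᵇ x
... | true  = cong (g (shrinkRow x xs) +_) (∑-map (x ∷_) g (removals xs))
... | false = ∑-map (x ∷_) g (removals xs)

down-suc : ∀ g x xs → first xs ≤ x → 0 < x →
           down g (suc x ∷ xs) ≡ g (x ∷ xs) + down (g ∘ (suc x ∷_)) xs
down-suc g x@(suc _) xs xs≤x _
  rewrite down-∷ g (suc x) xs | <⇒<ᵇ≡true {first xs} {suc x} (s≤s xs≤x) = refl

up-∷ : ∀ g x xs → up g (x ∷ xs) ≡ g (suc x ∷ xs) + upBelow x (g ∘ (x ∷_)) xs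
up-∷ g x xs = cong (g (suc x ∷ xs) +_) (∑-map (x ∷_) g (additionsBelow x xs))

upBelow-< : ∀ g x ν → first ν < x → upBelow x g ν ≡ up g ν
upBelow-< g x ν ν<x rewrite <⇒<ᵇ≡true ν<x = refl

upBelow-≥ : ∀ g x ν → x ≤ first ν → upBelow x g ν ≡ ∑ (addLowerRows ν) g
upBelow-≥ g x ν x≤ν rewrite ≥⇒<ᵇ≡false x≤ν = refl

upBelow-split : ∀ g x ν →
                upBelow x g ν ≡ (if first ν <ᵇ x then g (addFirstRow ν) else 0) + ∑ (addLowerRows ν) g
upBelow-split g x ν with first ν <ᵇ x
... | true  = refl
... | false = refl

up-shrinkRow : ∀ h x xs → first xs < x → IsShape xs →
               up h (shrinkRow x xs) ≡ h (x ∷ xs) + up (λ ν → if first ν <ᵇ x then h (shrinkRow x ν) else 0) xs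
up-shrinkRow h (suc zero) xs xs<1 s rewrite first<1⇒≡[] s xs<1 = refl
up-shrinkRow h x@(suc y@(suc _)) xs xs<x _ = begin
  up h (y ∷ xs)
    ≡⟨ up-∷ h y xs ⟩
  h (x ∷ xs) + upBelow y h′ xs
    ≡⟨ cong (h (x ∷ xs) +_) (upBelow-split h′ y xs) ⟩
  h (x ∷ xs) + ((if first xs <ᵇ y then h′ (addFirstRow xs) else 0) + ∑ (addLowerRows xs) h′)
    ≡⟨ cong (h (x ∷ xs) +_) (cong₂ _+_ first-row lower-rows) ⟩
  h (x ∷ xs) + up (λ ν → if first ν <ᵇ x then h′ ν else 0) xs ∎
  where
  open ≡-Reasoning
  h′ = h ∘ (y ∷_)
  first-row : (if first xs <ᵇ y then h′ (addFirstRow xs) else 0)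
                ≡ (if first (addFirstRow xs) <ᵇ x then h′ (addFirstRow xs) else 0)
  first-row = cong (λ b → if b then h′ (addFirstRow xs) else 0) (cong (_<ᵇ x) (sym (first-addFirstRow xs)))
  lower-rows : ∑ (addLowerRows xs) h′ ≡ ∑ (addLowerRows xs) (λ ν → if first ν <ᵇ x then h′ ν else 0)
  lower-rows = sym (∑-if-const (λ ν → first ν <ᵇ x) true h′
                     (All.map (λ e → <⇒<ᵇ≡true (subst (_< x) (sym e) xs<x)) (addLowerRows-first xs)))

-- The shapes covered by suc x ∷ ys are x ∷ ys and the addFirstRow ρ with ρ ⋖ x ∷ ys and
-- first ρ = x.
down-addFirstRow-exchange : ∀ g x ys → first ys ≤ x → 0 < x →
  down g (suc x ∷ ys) + down (λ ρ → if first ρ <ᵇ x then g (addFirstRow ρ) else 0) (x ∷ ys)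
    ≡ g (x ∷ ys) + down (g ∘ addFirstRow) (x ∷ ys)
down-addFirstRow-exchange g x ys ys≤x 0<x
  rewrite down-suc g x ys ys≤x 0<x
        | down-∷ (λ ρ → if first ρ <ᵇ x then g (addFirstRow ρ) else 0) x ys
        | down-∷ (g ∘ addFirstRow) x ys
        | ≥⇒<ᵇ≡false {x} {x} ≤-refl
        | ∑-zero (removals ys)
  with first ys <ᵇ x in eq
... | true rewrite <⇒<ᵇ≡true (first-shrinkRow x ys (<ᵇ≡true⇒< eq)) =
  rearrange (g (x ∷ ys)) (down (g ∘ (suc x ∷_)) ys) (g (addFirstRow (shrinkRow x ys)))
  where
  rearrange : ∀ a d c → a + d + (c + 0) ≡ a + (c + d)
  rearrange = solve-∀
... | false = +-identityʳ _

module _ (h : List ℕ → ℕ) (x : ℕ) where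
  open ≡-Reasoning

  upBelow-down-∷ : ∀ xs →
    upBelow x (λ ν → down h (x ∷ ν)) xs
      ≡ upBelow x (λ ν → if first ν <ᵇ x then h (shrinkRow x ν) else 0) xs + upBelow x (down (h ∘ (x ∷_))) xs
  upBelow-down-∷ xs = trans (∑-cong (additionsBelow x xs) (λ ν → down-∷ h x ν)) (∑-+ _ _ (additionsBelow x xs))

  upBelow-down-< : ∀ xs → first xs < x → IsShape xs →
    up (down (h ∘ (x ∷_))) xs ≡ h (x ∷ xs) + down (up (h ∘ (x ∷_))) xs →
    upBelow x (λ ν → down h (x ∷ ν)) xs ≡ up h (shrinkRow x xs) + down (upBelow x (h ∘ (x ∷_))) xs
  upBelow-down-< xs xs<x s up-down-xs = begin
    upBelow x (λ ν → down h (x ∷ ν)) xs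
      ≡⟨ upBelow-down-∷ xs ⟩
    upBelow x shrunk xs + upBelow x (down hₓ) xs
      ≡⟨ cong₂ _+_ (upBelow-< shrunk x xs xs<x) (trans (upBelow-< (down hₓ) x xs xs<x) up-down-xs) ⟩
    up shrunk xs + (hₓ xs + down (up hₓ) xs)
      ≡⟨ +-assoc (up shrunk xs) _ _ ⟨
    up shrunk xs + hₓ xs + down (up hₓ) xs
      ≡⟨ cong₂ _+_ (trans (+-comm (up shrunk xs) (hₓ xs)) (sym (up-shrinkRow h x xs xs<x s)))
                   (∑-cong-All (All.map (λ ρ≤xs → sym (upBelow-< hₓ x _ (≤-<-trans ρ≤xs xs<x)))
                                        (removals-first xs))) ⟩
    up h (shrinkRow x xs) + down (upBelow x hₓ) xs ∎
    where
    hₓ     = h ∘ (x ∷_)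
    shrunk = λ ν → if first ν <ᵇ x then h (shrinkRow x ν) else 0

  upBelow-down-≡ : ∀ ys → first ys ≤ x → 0 < x →
    up (down (h ∘ (x ∷_))) (x ∷ ys) ≡ h (x ∷ x ∷ ys) + down (up (h ∘ (x ∷_))) (x ∷ ys) →
    upBelow x (λ ν → down h (x ∷ ν)) (x ∷ ys) ≡ down (upBelow x (h ∘ (x ∷_))) (x ∷ ys)
  upBelow-down-≡ ys ys≤x 0<x up-down-xs = begin
    upBelow x (λ ν → down h (x ∷ ν)) xs
      ≡⟨ upBelow-down-∷ xs ⟩
    upBelow x shrunk xs + upBelow x (down hₓ) xs
      ≡⟨ cong₂ _+_ (trans (upBelow-≥ shrunk x xs ≤-refl) no-shrunk) (upBelow-≥ (down hₓ) x xs ≤-refl) ⟩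
    ∑ (addLowerRows xs) (down hₓ)
      ≡⟨ +-cancelˡ-≡ (down hₓ (suc x ∷ ys)) _ _ first-row-cancelled ⟩
    down (upBelow x hₓ) xs ∎
    where
    xs     = x ∷ ys
    hₓ     = h ∘ (x ∷_)
    shrunk = λ ν → if first ν <ᵇ x then h (shrinkRow x ν) else 0
    no-shrunk : ∑ (addLowerRows xs) shrunk ≡ 0
    no-shrunk = ∑-if-const (λ ν → first ν <ᵇ x) false _
                (All.map (λ e → trans (cong (_<ᵇ x) e) (≥⇒<ᵇ≡false {x} ≤-refl)) (addLowerRows-first xs))
    growFirst = λ ρ → if first ρ <ᵇ x then hₓ (addFirstRow ρ) else 0
    growLower = λ ρ → ∑ (addLowerRows ρ) hₓ
    first-row-cancelled : down hₓ (suc x ∷ ys) + ∑ (addLowerRows xs) (down hₓ)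
                            ≡ down hₓ (suc x ∷ ys) + down (upBelow x hₓ) xs
    first-row-cancelled = begin
      up (down hₓ) xs
        ≡⟨ up-down-xs ⟩
      hₓ xs + down (up hₓ) xs
        ≡⟨ cong (hₓ xs +_) (∑-+ (hₓ ∘ addFirstRow) growLower (removals xs)) ⟩
      hₓ xs + (down (hₓ ∘ addFirstRow) xs + down growLower xs)
        ≡⟨ +-assoc (hₓ xs) _ _ ⟨
      hₓ xs + down (hₓ ∘ addFirstRow) xs + down growLower xs
        ≡⟨ cong (_+ down growLower xs) (down-addFirstRow-exchange hₓ x ys ys≤x 0<x) ⟨
      down hₓ (suc x ∷ ys) + down growFirst xs + down growLower xs
        ≡⟨ +-assoc (down hₓ (suc x ∷ ys)) _ _ ⟩
      down hₓ (suc x ∷ ys) + (down growFirst xs + down growLower xs)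
        ≡⟨ cong (down hₓ (suc x ∷ ys) +_)
                (trans (∑-cong (removals xs) (λ ρ → upBelow-split hₓ x ρ))
                       (∑-+ growFirst growLower (removals xs))) ⟨
      down hₓ (suc x ∷ ys) + down (upBelow x hₓ) xs ∎

upBelow-down : ∀ h x xs → first xs ≤ x → 0 < x → IsShape xs →
  up (down (h ∘ (x ∷_))) xs ≡ h (x ∷ xs) + down (up (h ∘ (x ∷_))) xs →
  upBelow x (λ ν → down h (x ∷ ν)) xs
    ≡ (if first xs <ᵇ x then up h (shrinkRow x xs) else 0) + down (upBelow x (h ∘ (x ∷_))) xs
upBelow-down h x xs xs≤x 0<x s up-down-xs with m≤n⇒m<n∨m≡n xs≤x
... | inj₁ xs<x = trans (upBelow-down-< h x xs xs<x s up-down-xs)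
                        (cong (λ b → (if b then up h (shrinkRow x xs) else 0) + down (upBelow x (h ∘ (x ∷_))) xs)
                              (sym (<⇒<ᵇ≡true xs<x)))
upBelow-down h x (y ∷ ys) _ 0<x (ys≤y , _) up-down-xs | inj₂ refl =
  trans (upBelow-down-≡ h y ys ys≤y 0<x up-down-xs)
        (cong (λ b → (if b then up h (shrinkRow y (y ∷ ys)) else 0) + down (upBelow y (h ∘ (y ∷_))) (y ∷ ys))
              (sym (≥⇒<ᵇ≡false {y} ≤-refl)))

down-up-∷ : ∀ h x xs →
  down (up h) (x ∷ xs)
    ≡ (if first xs <ᵇ x then up h (shrinkRow x xs) else 0)
        + (down (h ∘ (suc x ∷_)) xs + down (upBelow x (h ∘ (x ∷_))) xs)
down-up-∷ h x xs =
  trans (down-∷ (up h) x xs)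
        (cong ((if first xs <ᵇ x then up h (shrinkRow x xs) else 0) +_)
              (trans (∑-cong (removals xs) (λ ρ → up-∷ h x ρ))
                     (∑-+ (h ∘ (suc x ∷_)) (upBelow x (h ∘ (x ∷_))) (removals xs))))

up-down : ∀ h μ → IsShape μ → up (down h) μ ≡ h μ + down (up h) μ
up-down h []       _                 = cong (_+ 0) (+-identityʳ (h []))
up-down h (x ∷ xs) (xs≤x , 0<x , s) = begin
  up (down h) (x ∷ xs)
    ≡⟨ up-∷ (down h) x xs ⟩
  down h (suc x ∷ xs) + upBelow x (λ ν → down h (x ∷ ν)) xs
    ≡⟨ cong₂ _+_ (down-suc h x xs xs≤x 0<x)
                 (upBelow-down h x xs xs≤x 0<x s (up-down (h ∘ (x ∷_)) xs s)) ⟩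
  h (x ∷ xs) + down (h ∘ (suc x ∷_)) xs + (c + down (upBelow x (h ∘ (x ∷_))) xs)
    ≡⟨ rearrange (h (x ∷ xs)) (down (h ∘ (suc x ∷_)) xs) c (down (upBelow x (h ∘ (x ∷_))) xs) ⟩
  h (x ∷ xs) + (c + (down (h ∘ (suc x ∷_)) xs + down (upBelow x (h ∘ (x ∷_))) xs))
    ≡⟨ cong (h (x ∷ xs) +_) (down-up-∷ h x xs) ⟨
  h (x ∷ xs) + down (up h) (x ∷ xs) ∎
  where
  open ≡-Reasoning
  c = if first xs <ᵇ x then up h (shrinkRow x xs) else 0
  rearrange : ∀ a b c d → a + b + (c + d) ≡ a + (c + (b + d))
  rearrange = solve-∀

-- Iterates of the operators, and the bound f_μ² ≤ |μ|!

down^ up^ : ℕ → (List ℕ → ℕ) → List ℕ → ℕ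
down^ zero    g = g
down^ (suc k) g = down (down^ k g)
up^ zero    g = g
up^ (suc k) g = up^ k (up g)

_≗ₛ_ : (List ℕ → ℕ) → (List ℕ → ℕ) → Set
g ≗ₛ h = ∀ μ → IsShape μ → g μ ≡ h μ

down-congₛ : ∀ {g h} → g ≗ₛ h → down g ≗ₛ down h
down-congₛ g≗h μ s = ∑-cong-All (All.map (λ {ρ} → g≗h ρ) (removals-IsShape μ s))

up-congₛ : ∀ {g h} → g ≗ₛ h → up g ≗ₛ up h
up-congₛ g≗h μ s = ∑-cong-All (All.map (λ {ν} → g≗h ν) (additions-IsShape μ s))

up^-congₛ : ∀ k {g h} → g ≗ₛ h → up^ k g ≗ₛ up^ k h
up^-congₛ zero    g≗h = g≗h
up^-congₛ (suc k) g≗h = up^-congₛ k (up-congₛ g≗h)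

down^-cong : ∀ k {g h} → (∀ ν → g ν ≡ h ν) → ∀ μ → down^ k g μ ≡ down^ k h μ
down^-cong zero    g≗h = g≗h
down^-cong (suc k) g≗h μ = ∑-cong (removals μ) (down^-cong k g≗h)

up^-cong : ∀ k {g h} → (∀ ν → g ν ≡ h ν) → ∀ μ → up^ k g μ ≡ up^ k h μ
up^-cong zero    g≗h = g≗h
up^-cong (suc k) g≗h = up^-cong k (λ ν → ∑-cong (additions ν) g≗h)

up^-mono : ∀ k {g h} → (∀ ν → g ν ≤ h ν) → ∀ μ → up^ k g μ ≤ up^ k h μ
up^-mono zero    g≤h = g≤h
up^-mono (suc k) g≤h = up^-mono k (λ ν → ∑-mono (additions ν) g≤h)

up^-*ˡ : ∀ k c g μ → up^ k (λ ν → c * g ν) μ ≡ c * up^ k g μ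
up^-*ˡ zero    c g μ = refl
up^-*ˡ (suc k) c g μ = trans (up^-cong k (λ ν → ∑-*ˡ c g (additions ν)) μ) (up^-*ˡ k c (up g) μ)

up^-∑ : ∀ k (F : A → List ℕ → ℕ) L μ →
        up^ k (λ ν → ∑ L (λ a → F a ν)) μ ≡ ∑ L (λ a → up^ k (F a) μ)
up^-∑ zero    F L μ = refl
up^-∑ (suc k) F L μ =
  trans (up^-cong k (λ ν → ∑-comm (λ ν′ a → F a ν′) (additions ν) L) μ) (up^-∑ k (up ∘ F) L μ)

down^-zero : ∀ k μ → down^ k (λ _ → 0) μ ≡ 0
down^-zero zero    μ = refl
down^-zero (suc k) μ = ∑-vanishes (removals μ) (down^-zero k)

up-down^ : ∀ b g → up (down^ (suc b) g) ≗ₛ λ μ → down^ (suc b) (up g) μ + suc b * down^ b g μ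
up-down^ zero    g μ s = trans (up-down g μ s) (trans (+-comm (g μ) _) (cong (down (up g) μ +_) (sym (*-identityˡ (g μ)))))
up-down^ (suc b) g μ s = begin
  up (down (down^ (suc b) g)) μ
    ≡⟨ up-down (down^ (suc b) g) μ s ⟩
  down^ (suc b) g μ + down (up (down^ (suc b) g)) μ
    ≡⟨ cong (down^ (suc b) g μ +_) (down-congₛ (up-down^ b g) μ s) ⟩
  down^ (suc b) g μ + down (λ ρ → down^ (suc b) (up g) ρ + suc b * down^ b g ρ) μ
    ≡⟨ cong (down^ (suc b) g μ +_) (trans (∑-+ _ _ (removals μ))
                                         (cong (down^ (suc (suc b)) (up g) μ +_) (∑-*ˡ (suc b) (down^ b g) (removals μ)))) ⟩
  down^ (suc b) g μ + (down^ (suc (suc b)) (up g) μ + suc b * down^ (suc b) g μ)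
    ≡⟨ rearrange (down^ (suc b) g μ) (down^ (suc (suc b)) (up g) μ) b ⟩
  down^ (suc (suc b)) (up g) μ + suc (suc b) * down^ (suc b) g μ ∎
  where
  open ≡-Reasoning
  rearrange : ∀ a c b → a + (c + suc b * a) ≡ c + suc (suc b) * a
  rearrange = solve-∀

δ : List ℕ → List ℕ → ℕ
δ []       []       = 1
δ (a ∷ as) (b ∷ bs) = if does (a ≟ b) then δ as bs else 0
δ _        _        = 0

δ-sym : ∀ μ ν → δ μ ν ≡ δ ν μ
δ-sym []       []       = refl
δ-sym []       (_ ∷ _)  = refl
δ-sym (_ ∷ _)  []       = refl
δ-sym (a ∷ as) (b ∷ bs) with a ≟ b | b ≟ a
... | yes refl | _        rewrite dec-true (a ≟ a) refl = δ-sym as bs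
... | no  a≢b  | yes refl = ⊥-elim (a≢b refl)
... | no  a≢b  | no  b≢a  rewrite dec-false (a ≟ b) a≢b | dec-false (b ≟ a) b≢a = refl

*-δ-≤ : ∀ (g : List ℕ → ℕ) μ ν → g μ * δ μ ν ≤ g ν
*-δ-≤ g []       []       = ≤-reflexive (*-identityʳ (g []))
*-δ-≤ g []       (_ ∷ _)  = ≤-trans (≤-reflexive (*-zeroʳ (g []))) z≤n
*-δ-≤ g (a ∷ as) []       = ≤-trans (≤-reflexive (*-zeroʳ (g (a ∷ as)))) z≤n
*-δ-≤ g (a ∷ as) (b ∷ bs) with a ≟ b
... | yes refl rewrite dec-true (a ≟ a) refl = *-δ-≤ (g ∘ (a ∷_)) as bs
... | no  a≢b  rewrite dec-false (a ≟ b) a≢b = ≤-trans (≤-reflexive (*-zeroʳ (g (a ∷ as)))) z≤n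

δ-first≢ : ∀ μ ν → first μ ≢ first ν → δ μ ν ≡ 0
δ-first≢ []       []       ne = ⊥-elim (ne refl)
δ-first≢ []       (_ ∷ _)  _  = refl
δ-first≢ (_ ∷ _)  []       _  = refl
δ-first≢ (a ∷ as) (b ∷ bs) ne rewrite dec-false (a ≟ b) ne = refl

up-vanishes : ∀ g ρ → (∀ a as → g (a ∷ as) ≡ 0) → up g ρ ≡ 0
up-vanishes g []       g∷≡0 rewrite g∷≡0 1 [] = refl
up-vanishes g (y ∷ ys) g∷≡0 rewrite g∷≡0 (suc y) ys =
  trans (∑-map (y ∷_) g (additionsBelow y ys)) (∑-vanishes (additionsBelow y ys) (g∷≡0 y))

δ[]-shrinkRow : ∀ y ys → IsShape (y ∷ ys) →
          (if first ys <ᵇ y then δ [] (shrinkRow y ys) else 0) ≡ δ (1 ∷ []) (y ∷ ys)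
δ[]-shrinkRow 1             []            _                    = refl
δ[]-shrinkRow 1             (suc _ ∷ _)   _                    = refl
δ[]-shrinkRow (suc (suc k)) ys            _ with first ys <ᵇ suc (suc k)
... | true  = refl
... | false = refl

down-δ[] : ∀ μ → IsShape μ → down (δ []) μ ≡ up (λ ν → δ ν μ) []
down-δ[] []       _ = refl
down-δ[] (y ∷ ys) s = begin
  down (δ []) (y ∷ ys)
    ≡⟨ down-∷ (δ []) y ys ⟩
  (if first ys <ᵇ y then δ [] (shrinkRow y ys) else 0) + ∑ (removals ys) (λ _ → 0)
    ≡⟨ cong₂ _+_ (δ[]-shrinkRow y ys s) (∑-zero (removals ys)) ⟩
  δ (1 ∷ []) (y ∷ ys) + 0 ∎
  where open ≡-Reasoning

δ-shrinkRow-≡ : ∀ y zs ys → IsShape (y ∷ ys) →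
          (if first ys <ᵇ y then δ (y ∷ zs) (shrinkRow y ys) else 0) ≡ 0
δ-shrinkRow-≡ y zs ys (_ , _ , s) with first ys <ᵇ y in eq
... | false = refl
δ-shrinkRow-≡ 1             zs ys (_ , _ , s) | true rewrite first<1⇒≡[] s (<ᵇ≡true⇒< eq) = refl
δ-shrinkRow-≡ (suc (suc k)) zs ys _           | true rewrite dec-false (suc (suc k) ≟ suc k) 1+n≢n = refl

δ-shrinkRow-≢ : ∀ y z zs ys → IsShape (y ∷ ys) → IsShape (z ∷ zs) → z ≢ y →
          (if first ys <ᵇ y then δ (z ∷ zs) (shrinkRow y ys) else 0) ≡ δ (suc z ∷ zs) (y ∷ ys)
δ-shrinkRow-≢ y z zs ys _ (zs≤z , _) _ with y ≟ suc z
δ-shrinkRow-≢ _ z@(suc _) zs ys _ (zs≤z , _) _ | yes refl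
  rewrite dec-true (z ≟ z) refl with first ys <ᵇ suc z in eq
... | true  = refl
... | false =
  sym (δ-first≢ zs ys (λ zs≡ys → <⇒≱ (s≤s zs≤z) (subst (suc z ≤_) (sym zs≡ys) (<ᵇ≡false⇒≥ eq))))
δ-shrinkRow-≢ y z zs ys (_ , _ , s) _ z≢y | no y≢1+z
  rewrite dec-false (suc z ≟ y) (y≢1+z ∘ sym) with first ys <ᵇ y in eq
... | false = refl
δ-shrinkRow-≢ 1             z zs ys (_ , _ , s) _ _ | no _ | true rewrite first<1⇒≡[] s (<ᵇ≡true⇒< eq) = refl
δ-shrinkRow-≢ (suc (suc k)) z zs ys _ _ _ | no y≢1+z | true
  rewrite dec-false (z ≟ suc k) (λ z≡1+k → y≢1+z (cong suc (sym z≡1+k))) = refl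

up-δ≡upBelow : ∀ z zs ys → first zs ≤ z → first ys ≤ z →
               up (λ ν → δ ν ys) zs ≡ upBelow z (λ ν → δ ν ys) zs
up-δ≡upBelow z zs ys zs≤z ys≤z with m≤n⇒m<n∨m≡n zs≤z
... | inj₁ zs<z = sym (upBelow-< _ z zs zs<z)
... | inj₂ zs≡z = begin
  δ (addFirstRow zs) ys + ∑ (addLowerRows zs) (λ ν → δ ν ys)
    ≡⟨ cong (_+ ∑ (addLowerRows zs) (λ ν → δ ν ys)) (δ-first≢ (addFirstRow zs) ys first-differs) ⟩
  ∑ (addLowerRows zs) (λ ν → δ ν ys)
    ≡⟨ upBelow-≥ _ z zs (≤-reflexive (sym zs≡z)) ⟨
  upBelow z (λ ν → δ ν ys) zs ∎
  where
  open ≡-Reasoning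
  first-differs : first (addFirstRow zs) ≢ first ys
  first-differs e =
    <⇒≱ (s≤s ys≤z) (subst (_≤ first ys) (trans (first-addFirstRow zs) (cong suc zs≡z)) (≤-reflexive e))

δ-∷-≡ : ∀ a as bs → δ (a ∷ as) (a ∷ bs) ≡ δ as bs
δ-∷-≡ a as bs rewrite dec-true (a ≟ a) refl = refl

δ-∷-≢ : ∀ {a b} as bs → a ≢ b → δ (a ∷ as) (b ∷ bs) ≡ 0
δ-∷-≢ {a} {b} as bs a≢b rewrite dec-false (a ≟ b) a≢b = refl

down-δ≡up-δ : ∀ μ ρ → IsShape μ → IsShape ρ → down (δ ρ) μ ≡ up (λ ν → δ ν μ) ρ
down-δ≡up-δ []       ρ  _ _ = sym (up-vanishes (λ ν → δ ν []) ρ (λ _ _ → refl))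
down-δ≡up-δ (y ∷ ys) [] s _ = down-δ[] (y ∷ ys) s
down-δ≡up-δ (y ∷ ys) (z ∷ zs) sμ@(ys≤y , _ , s-ys) sρ@(zs≤z , _ , s-zs) with z ≟ y
... | yes refl = begin
  down (δ (z ∷ zs)) (z ∷ ys)
    ≡⟨ down-∷ (δ (z ∷ zs)) z ys ⟩
  (if first ys <ᵇ z then δ (z ∷ zs) (shrinkRow z ys) else 0) + down (λ ρ → δ (z ∷ zs) (z ∷ ρ)) ys
    ≡⟨ cong₂ _+_ (δ-shrinkRow-≡ z zs ys sμ) (∑-cong (removals ys) (δ-∷-≡ z zs)) ⟩
  down (δ zs) ys
    ≡⟨ down-δ≡up-δ ys zs s-ys s-zs ⟩
  up (λ ν → δ ν ys) zs
    ≡⟨ up-δ≡upBelow z zs ys zs≤z ys≤y ⟩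
  upBelow z (λ ν → δ ν ys) zs
    ≡⟨ cong₂ _+_ (δ-∷-≢ zs ys (1+n≢n {z})) (∑-cong (additionsBelow z zs) (λ ν → δ-∷-≡ z ν ys)) ⟨
  δ (suc z ∷ zs) (z ∷ ys) + upBelow z (λ ν → δ (z ∷ ν) (z ∷ ys)) zs
    ≡⟨ up-∷ (λ ν → δ ν (z ∷ ys)) z zs ⟨
  up (λ ν → δ ν (z ∷ ys)) (z ∷ zs) ∎
  where open ≡-Reasoning
... | no z≢y = begin
  down (δ (z ∷ zs)) (y ∷ ys)
    ≡⟨ down-∷ (δ (z ∷ zs)) y ys ⟩
  (if first ys <ᵇ y then δ (z ∷ zs) (shrinkRow y ys) else 0) + down (λ ρ → δ (z ∷ zs) (y ∷ ρ)) ys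
    ≡⟨ cong₂ _+_ (δ-shrinkRow-≢ y z zs ys sμ sρ z≢y) (∑-vanishes (removals ys) (λ ρ → δ-∷-≢ zs ρ z≢y)) ⟩
  δ (suc z ∷ zs) (y ∷ ys) + 0
    ≡⟨ cong (δ (suc z ∷ zs) (y ∷ ys) +_) (∑-vanishes (additionsBelow z zs) (λ ν → δ-∷-≢ ν ys z≢y)) ⟨
  δ (suc z ∷ zs) (y ∷ ys) + upBelow z (λ ν → δ (z ∷ ν) (y ∷ ys)) zs
    ≡⟨ up-∷ (λ ν → δ ν (y ∷ ys)) z zs ⟨
  up (λ ν → δ ν (y ∷ ys)) (z ∷ zs) ∎
  where open ≡-Reasoning

sytChains≡down^ : ∀ k μ → sytChains k μ ≡ down^ k (δ []) μ
sytChains≡down^ zero    []      = refl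
sytChains≡down^ zero    (_ ∷ _) = refl
sytChains≡down^ (suc k) μ       = ∑-cong (removals μ) (sytChains≡down^ k)

up^-down^-δ[] : ∀ k → up^ k (down^ k (δ [])) [] ≡ k !
up^-down^-δ[] zero    = refl
up^-down^-δ[] (suc k) = begin
  up^ k (up (down^ (suc k) (δ []))) []
    ≡⟨ up^-congₛ k up-down^-δ[] [] tt ⟩
  up^ k (λ ν → suc k * down^ k (δ []) ν) []
    ≡⟨ up^-*ˡ k (suc k) (down^ k (δ [])) [] ⟩
  suc k * up^ k (down^ k (δ [])) []
    ≡⟨ cong (suc k *_) (up^-down^-δ[] k) ⟩
  suc k * k ! ∎
  where
  open ≡-Reasoning
  up-δ[] : ∀ μ → up (δ []) μ ≡ 0
  up-δ[] μ = up-vanishes (δ []) μ (λ _ _ → refl)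
  up-down^-δ[] : up (down^ (suc k) (δ [])) ≗ₛ λ ν → suc k * down^ k (δ []) ν
  up-down^-δ[] μ s = trans (up-down^ k (δ []) μ s)
    (cong (_+ suc k * down^ k (δ []) μ) (trans (down^-cong (suc k) up-δ[] μ) (down^-zero (suc k) μ)))

up^-δ≡down^-δ : ∀ k ρ μ → IsShape ρ → IsShape μ → up^ k (δ μ) ρ ≡ down^ k (δ ρ) μ
up^-δ≡down^-δ zero    ρ μ _   _   = δ-sym μ ρ
up^-δ≡down^-δ (suc k) ρ μ s-ρ s-μ = begin
  up^ k (up (δ μ)) ρ
    ≡⟨ up^-congₛ k up-δ≡down-δ ρ s-ρ ⟩
  up^ k (λ ν → ∑ (removals μ) (λ ρ′ → δ ρ′ ν)) ρ
    ≡⟨ up^-∑ k δ (removals μ) ρ ⟩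
  ∑ (removals μ) (λ ρ′ → up^ k (δ ρ′) ρ)
    ≡⟨ ∑-cong-All (All.map (λ {ρ′} s-ρ′ → up^-δ≡down^-δ k ρ ρ′ s-ρ s-ρ′) (removals-IsShape μ s-μ)) ⟩
  down^ (suc k) (δ ρ) μ ∎
  where
  open ≡-Reasoning
  up-δ≡down-δ : up (δ μ) ≗ₛ λ ν → ∑ (removals μ) (λ ρ′ → δ ρ′ ν)
  up-δ≡down-δ ν s-ν = begin
    up (δ μ) ν                        ≡⟨ ∑-cong (additions ν) (δ-sym μ) ⟩
    up (λ ν′ → δ ν′ μ) ν              ≡⟨ down-δ≡up-δ μ ν s-μ s-ν ⟨
    down (δ ν) μ                      ≡⟨ ∑-cong (removals μ) (δ-sym ν) ⟩
    ∑ (removals μ) (λ ρ′ → δ ρ′ ν)    ∎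

sytChains²≤! : ∀ k μ → IsShape μ → sytChains k μ * sytChains k μ ≤ k !
sytChains²≤! k μ s rewrite sytChains≡down^ k μ = begin
  F μ * F μ                  ≡⟨ cong (F μ *_) (up^-δ≡down^-δ k [] μ tt s) ⟨
  F μ * up^ k (δ μ) []       ≡⟨ up^-*ˡ k (F μ) (δ μ) [] ⟨
  up^ k (λ ν → F μ * δ μ ν) [] ≤⟨ up^-mono k (*-δ-≤ F μ) [] ⟩
  up^ k F []                 ≡⟨ up^-down^-δ[] k ⟩
  k !                        ∎
  where
  open ≤-Reasoning
  F = down^ k (δ [])

-- The multinomial bound

^-distribʳ-* : ∀ m n o → (m * n) ^ o ≡ m ^ o * n ^ o
^-distribʳ-* m n zero    = refl
^-distribʳ-* m n (suc o) = trans (cong (m * n *_) (^-distribʳ-* m n o)) (*-interchange m n (m ^ o) (n ^ o))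

product-map-^2 : ∀ (g : ℕ → ℕ) L → product (map (λ x → g x ^ 2) L) ≡ product (map g L) ^ 2
product-map-^2 g []      = refl
product-map-^2 g (x ∷ L) =
  trans (cong (g x ^ 2 *_) (product-map-^2 g L)) (sym (^-distribʳ-* (g x) (product (map g L)) 2))

x^2≡x*x : ∀ x → x ^ 2 ≡ x * x
x^2≡x*x x = cong (x *_) (*-identityʳ x)

choose*!*!≡! : ∀ x k → ((x + k) choose x) * (x ! * k !) ≡ (x + k) !
choose*!*!≡! x k = begin
  ((x + k) choose x) * (x ! * k !)
    ≡⟨ cong₂ _*_ (nCk≡n!/k![n-k]! x≤x+k) (cong (λ j → x ! * j !) (sym (m+n∸m≡n x k))) ⟩
  (x + k) ! / (x ! * (x + k ∸ x) !) * (x ! * (x + k ∸ x) !)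
    ≡⟨ m/n*n≡m (k![n∸k]!∣n! x≤x+k) ⟩
  (x + k) ! ∎
  where
  open ≡-Reasoning
  x≤x+k = m≤m+n x k
  instance _ = _!*_!≢0 x (x + k ∸ x)

[m+s]!≤[m+s]^m*s! : ∀ m s → (m + s) ! ≤ (m + s) ^ m * s !
[m+s]!≤[m+s]^m*s! zero    s = ≤-reflexive (sym (+-identityʳ (s !)))
[m+s]!≤[m+s]^m*s! (suc m) s = begin
  suc (m + s) * (m + s) !
    ≤⟨ *-monoʳ-≤ (suc (m + s)) ([m+s]!≤[m+s]^m*s! m s) ⟩
  suc (m + s) * ((m + s) ^ m * s !)
    ≤⟨ *-monoʳ-≤ (suc (m + s)) (*-monoˡ-≤ (s !) (^-monoˡ-≤ m (n≤1+n (m + s)))) ⟩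
  suc (m + s) * (suc (m + s) ^ m * s !)
    ≡⟨ *-assoc (suc (m + s)) (suc (m + s) ^ m) (s !) ⟨
  suc (m + s) ^ suc m * s ! ∎
  where open ≤-Reasoning

sytChains-vanishes : ∀ k μ → k < sum μ → sytChains k μ ≡ 0
sytChains-vanishes zero    (_ ∷ _) _   = refl
sytChains-vanishes (suc k) μ       k<μ =
  trans (∑-cong-All (All.map (λ {ν} e → sytChains-vanishes k ν (s<s⁻¹ (subst (suc k <_) (sym e) k<μ)))
                             (removals-size μ)))
        (∑-zero (removals μ))

sytChains-row : ∀ m → sytChains (suc m) (suc m ∷ []) ≡ 1
sytChains-row zero    = refl
sytChains-row (suc m) = trans (+-identityʳ _) (sytChains-row m)

sytChains-∷-≤ : ∀ x k ν → IsShape (x ∷ ν) → sytChains (x + k) (x ∷ ν) ≤ ((x + k) choose x) * sytChains k ν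
sytChains-∷-≤ (suc x) zero [] _
  rewrite +-identityʳ x | sytChains-row x | nCn≡1 (suc x) = ≤-refl
sytChains-∷-≤ (suc x) zero (y ∷ ys) (_ , _ , _ , 0<y , _) =
  ≤-trans (≤-reflexive (sytChains-vanishes (suc x + 0) (suc x ∷ y ∷ ys) x+0<x+y+ys)) z≤n
  where x+0<x+y+ys = +-monoʳ-< (suc x) (≤-trans 0<y (m≤m+n y (sum ys)))
sytChains-∷-≤ (suc x) (suc k) ν (ν≤x , _ , s) = begin
  sytChains (suc N) (suc x ∷ ν)
    ≡⟨ down-∷ (sytChains N) (suc x) ν ⟩
  (if first ν <ᵇ suc x then sytChains N (shrinkRow (suc x) ν) else 0) + down (sytChains N ∘ (suc x ∷_)) ν
    ≤⟨ +-mono-≤ remove-from-first-row remove-below ⟩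
  (N choose x) * sytChains (suc k) ν + (N choose suc x) * sytChains (suc k) ν
    ≡⟨ *-distribʳ-+ (sytChains (suc k) ν) (N choose x) (N choose suc x) ⟨
  (N choose x + N choose suc x) * sytChains (suc k) ν
    ≡⟨ cong (_* sytChains (suc k) ν) (nCk+nC[k+1]≡[n+1]C[k+1] N x) ⟩
  (suc N choose suc x) * sytChains (suc k) ν ∎
  where
  open ≤-Reasoning
  N = x + suc k
  remove-from-first-row : (if first ν <ᵇ suc x then sytChains N (shrinkRow (suc x) ν) else 0)
                            ≤ (N choose x) * sytChains (suc k) ν
  remove-from-first-row with first ν <ᵇ suc x in eq
  ... | false = z≤n
  ... | true  = shrinkRow-bound x (<ᵇ≡true⇒< eq)
    where
    shrinkRow-bound : ∀ x → first ν < suc x →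
      sytChains (x + suc k) (shrinkRow (suc x) ν) ≤ ((x + suc k) choose x) * sytChains (suc k) ν
    shrinkRow-bound zero     _    = ≤-reflexive (sym (+-identityʳ _))
    shrinkRow-bound (suc x′) ν<x = sytChains-∷-≤ (suc x′) (suc k) ν (s≤s⁻¹ ν<x , s≤s z≤n , s)
  remove-below : down (sytChains N ∘ (suc x ∷_)) ν ≤ (N choose suc x) * sytChains (suc k) ν
  remove-below = begin
    down (sytChains N ∘ (suc x ∷_)) ν
      ≤⟨ ∑-mono-All (All.map bound (All.zip (removals-first ν , removals-IsShape ν s))) ⟩
    ∑ (removals ν) (λ ρ → (N choose suc x) * sytChains k ρ)
      ≡⟨ ∑-*ˡ (N choose suc x) (sytChains k) (removals ν) ⟩
    (N choose suc x) * sytChains (suc k) ν ∎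
    where
    bound : ∀ {ρ} → first ρ ≤ first ν × IsShape ρ → sytChains N (suc x ∷ ρ) ≤ (N choose suc x) * sytChains k ρ
    bound {ρ} (ρ≤ν , s-ρ) = subst (λ n → sytChains n (suc x ∷ ρ) ≤ (n choose suc x) * sytChains k ρ)
                                  (sym (+-suc x k))
                                  (sytChains-∷-≤ (suc x) k ρ (≤-trans ρ≤ν ν≤x , s≤s z≤n , s-ρ))

f-++-≤ : ∀ A B → IsShape (A ++ B) → f (A ++ B) * (product (map _! A) * ∣ B ∣ₚ !) ≤ ∣ A ++ B ∣ₚ ! * f B
f-++-≤ []      B _ = ≤-reflexive (trans (cong (f B *_) (*-identityˡ _)) (*-comm (f B) _))
f-++-≤ (x ∷ A) B s@(_ , _ , s-A++B) = begin
  sytChains (x + k) (x ∷ A ++ B) * (x ! * Q * r)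
    ≤⟨ *-monoˡ-≤ (x ! * Q * r) (sytChains-∷-≤ x k (A ++ B) s) ⟩
  ((x + k) choose x) * f (A ++ B) * (x ! * Q * r)
    ≡⟨ regroup ((x + k) choose x) (f (A ++ B)) (x !) Q r ⟩
  ((x + k) choose x) * x ! * (f (A ++ B) * (Q * r))
    ≤⟨ *-monoʳ-≤ (((x + k) choose x) * x !) (f-++-≤ A B s-A++B) ⟩
  ((x + k) choose x) * x ! * (k ! * f B)
    ≡⟨ regroup′ ((x + k) choose x) (x !) (k !) (f B) ⟩
  ((x + k) choose x) * (x ! * k !) * f B
    ≡⟨ cong (_* f B) (choose*!*!≡! x k) ⟩
  (x + k) ! * f B ∎
  where
  open ≤-Reasoning
  k = ∣ A ++ B ∣ₚ
  Q = product (map _! A)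
  r = ∣ B ∣ₚ !
  regroup : ∀ c F a Q r → c * F * (a * Q * r) ≡ c * a * (F * (Q * r))
  regroup = solve-∀
  regroup′ : ∀ c a b G → c * a * (b * G) ≡ c * (a * b) * G
  regroup′ = solve-∀

-- Content sums

open import Data.Integer as ℤ using (ℤ; +_; -[1+_])
import Data.Integer.Properties as ℤₚ
import Data.Integer.Tactic.RingSolver as ℤ-Solver

rowContentFormula : ℕ → ℕ → ℤ
rowContentFormula i x = (+ x ℤ.* (+ x ℤ.- + (2 * i) ℤ.+ + 1)) ℤ./ + 2

2*n/2≡n : ∀ n → 2 * n ℕ./ 2 ≡ n
2*n/2≡n n = trans (cong (ℕ._/ 2) (*-comm 2 n)) (m*n/n≡m n 2)

2*n%2≡0 : ∀ n → 2 * n ℕ.% 2 ≡ 0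
2*n%2≡0 n = trans (cong (ℕ._% 2) (*-comm 2 n)) (m*n%n≡0 n 2)

2*i/2≡i : ∀ i → (+ 2 ℤ.* i) ℤ./ + 2 ≡ i
2*i/2≡i (+ zero)  = refl
2*i/2≡i (+ suc k) = trans (ℤₚ.*-identityˡ _) (cong +_ (2*n/2≡n (suc k)))
2*i/2≡i -[1+ k ]  rewrite 2*n%2≡0 (suc k) | 2*n/2≡n (suc k) = ℤₚ.*-identityˡ _

2*rowContent : ∀ i x → + 2 ℤ.* rowContent i x ≡ + x ℤ.* (+ x ℤ.- + 2 ℤ.* + i ℤ.+ + 1)
2*rowContent i zero    = refl
2*rowContent i (suc x) = begin
  + 2 ℤ.* (rowContent i x ℤ.+ (+ 1 ℤ.+ + x ℤ.- + i))
    ≡⟨ ℤₚ.*-distribˡ-+ (+ 2) (rowContent i x) _ ⟩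
  + 2 ℤ.* rowContent i x ℤ.+ + 2 ℤ.* (+ 1 ℤ.+ + x ℤ.- + i)
    ≡⟨ cong (ℤ._+ + 2 ℤ.* (+ 1 ℤ.+ + x ℤ.- + i)) (2*rowContent i x) ⟩
  + x ℤ.* (+ x ℤ.- + 2 ℤ.* + i ℤ.+ + 1) ℤ.+ + 2 ℤ.* (+ 1 ℤ.+ + x ℤ.- + i)
    ≡⟨ step (+ x) (+ i) ⟩
  (+ 1 ℤ.+ + x) ℤ.* ((+ 1 ℤ.+ + x) ℤ.- + 2 ℤ.* + i ℤ.+ + 1) ∎
  where
  open ≡-Reasoning
  step : ∀ X I → X ℤ.* (X ℤ.- + 2 ℤ.* I ℤ.+ + 1) ℤ.+ + 2 ℤ.* (+ 1 ℤ.+ X ℤ.- I)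
                   ≡ (+ 1 ℤ.+ X) ℤ.* ((+ 1 ℤ.+ X) ℤ.- + 2 ℤ.* I ℤ.+ + 1)
  step = ℤ-Solver.solve-∀

rowContent≡rowContentFormula : ∀ i x → rowContent i x ≡ rowContentFormula i x
rowContent≡rowContentFormula i x = sym (begin
  (+ x ℤ.* (+ x ℤ.- + (2 * i) ℤ.+ + 1)) ℤ./ + 2
    ≡⟨ cong (λ j → (+ x ℤ.* (+ x ℤ.- j ℤ.+ + 1)) ℤ./ + 2) (ℤₚ.pos-* 2 i) ⟩
  (+ x ℤ.* (+ x ℤ.- + 2 ℤ.* + i ℤ.+ + 1)) ℤ./ + 2
    ≡⟨ cong (ℤ._/ + 2) (2*rowContent i x) ⟨
  (+ 2 ℤ.* rowContent i x) ℤ./ + 2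
    ≡⟨ 2*i/2≡i (rowContent i x) ⟩
  rowContent i x ∎)
  where open ≡-Reasoning

-- Stated for any h agreeing with (i +_): the tail of applyUpTo (i +_) is applyUpTo (λ j → i + suc j).
contentFrom≡ΣrowContentFormula : ∀ (h : ℕ → ℕ) i L → (∀ j → h j ≡ i + j) →
                         contentFrom i L ≡ Σℤ (zipWith rowContentFormula (applyUpTo h (length L)) L)
contentFrom≡ΣrowContentFormula h i []      _      = refl
contentFrom≡ΣrowContentFormula h i (x ∷ L) h≡i+ = cong₂ ℤ._+_
  (trans (rowContent≡rowContentFormula i x) (cong (λ j → rowContentFormula j x) (sym (trans (h≡i+ 0) (+-identityʳ i)))))
  (contentFrom≡ΣrowContentFormula (h ∘ suc) (suc i) L (λ j → trans (h≡i+ (suc j)) (+-suc i j)))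

contentFrom-++ : ∀ i A B → contentFrom i (A ++ B) ≡ contentFrom i A ℤ.+ contentFrom (i + length A) B
contentFrom-++ i []      B = trans (sym (ℤₚ.+-identityˡ _)) (cong (λ j → + 0 ℤ.+ contentFrom j B) (sym (+-identityʳ i)))
contentFrom-++ i (x ∷ A) B = begin
  rowContent i x ℤ.+ contentFrom (suc i) (A ++ B)
    ≡⟨ cong (λ s → rowContent i x ℤ.+ s) (contentFrom-++ (suc i) A B) ⟩
  rowContent i x ℤ.+ (contentFrom (suc i) A ℤ.+ contentFrom (suc i + length A) B)
    ≡⟨ cong (λ j → rowContent i x ℤ.+ (contentFrom (suc i) A ℤ.+ contentFrom j B)) (sym (+-suc i (length A))) ⟩
  rowContent i x ℤ.+ (contentFrom (suc i) A ℤ.+ contentFrom (i + suc (length A)) B)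
    ≡⟨ ℤₚ.+-assoc (rowContent i x) _ _ ⟨
  rowContent i x ℤ.+ contentFrom (suc i) A ℤ.+ contentFrom (i + suc (length A)) B ∎
  where open ≡-Reasoning

rowContent-shift : ∀ i p x → rowContent (i + p) x ≡ rowContent i x ℤ.- + p ℤ.* + x
rowContent-shift i p zero    = cong (λ z → + 0 ℤ.- z) (sym (ℤₚ.*-zeroʳ (+ p)))
rowContent-shift i p (suc x) = begin
  rowContent (i + p) x ℤ.+ (+ suc x ℤ.- + (i + p))
    ≡⟨ cong₂ (λ r s → r ℤ.+ (+ suc x ℤ.- s)) (rowContent-shift i p x) (ℤₚ.pos-+ i p) ⟩
  (rowContent i x ℤ.- + p ℤ.* + x) ℤ.+ (+ 1 ℤ.+ + x ℤ.- (+ i ℤ.+ + p))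
    ≡⟨ step (rowContent i x) (+ x) (+ i) (+ p) ⟩
  (rowContent i x ℤ.+ (+ 1 ℤ.+ + x ℤ.- + i)) ℤ.- + p ℤ.* (+ 1 ℤ.+ + x) ∎
  where
  open ≡-Reasoning
  step : ∀ R X I P → (R ℤ.- P ℤ.* X) ℤ.+ (+ 1 ℤ.+ X ℤ.- (I ℤ.+ P))
                       ≡ (R ℤ.+ (+ 1 ℤ.+ X ℤ.- I)) ℤ.- P ℤ.* (+ 1 ℤ.+ X)
  step = ℤ-Solver.solve-∀

contentFrom-shift : ∀ i p B → contentFrom (i + p) B ≡ contentFrom i B ℤ.- + p ℤ.* + sum B
contentFrom-shift i p []      = cong (λ z → + 0 ℤ.- z) (sym (ℤₚ.*-zeroʳ (+ p)))
contentFrom-shift i p (x ∷ B) = begin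
  rowContent (i + p) x ℤ.+ contentFrom (suc i + p) B
    ≡⟨ cong₂ ℤ._+_ (rowContent-shift i p x) (contentFrom-shift (suc i) p B) ⟩
  (rowContent i x ℤ.- + p ℤ.* + x) ℤ.+ (contentFrom (suc i) B ℤ.- + p ℤ.* + sum B)
    ≡⟨ step (rowContent i x) (contentFrom (suc i) B) (+ p) (+ x) (+ sum B) ⟩
  (rowContent i x ℤ.+ contentFrom (suc i) B) ℤ.- + p ℤ.* (+ x ℤ.+ + sum B)
    ≡⟨ cong (λ s → (rowContent i x ℤ.+ contentFrom (suc i) B) ℤ.- + p ℤ.* s) (sym (ℤₚ.pos-+ x (sum B))) ⟩
  (rowContent i x ℤ.+ contentFrom (suc i) B) ℤ.- + p ℤ.* + (x + sum B) ∎
  where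
  open ≡-Reasoning
  step : ∀ R C P X S → (R ℤ.- P ℤ.* X) ℤ.+ (C ℤ.- P ℤ.* S) ≡ (R ℤ.+ C) ℤ.- P ℤ.* (X ℤ.+ S)
  step = ℤ-Solver.solve-∀

C-++ : ∀ A B → C (A ++ B) ≡ C A ℤ.- + (length A * sum B) ℤ.+ C B
C-++ A B = begin
  C (A ++ B)
    ≡⟨ contentFrom-++ 1 A B ⟩
  C A ℤ.+ contentFrom (1 + length A) B
    ≡⟨ cong (λ s → C A ℤ.+ s) (contentFrom-shift 1 (length A) B) ⟩
  C A ℤ.+ (C B ℤ.- + length A ℤ.* + sum B)
    ≡⟨ cong (λ s → C A ℤ.+ (C B ℤ.- s)) (ℤₚ.pos-* (length A) (sum B)) ⟨
  C A ℤ.+ (C B ℤ.- + (length A * sum B))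
    ≡⟨ step (C A) (C B) _ ⟩
  C A ℤ.- + (length A * sum B) ℤ.+ C B ∎
  where
  open ≡-Reasoning
  step : ∀ A B X → A ℤ.+ (B ℤ.- X) ≡ A ℤ.- X ℤ.+ B
  step = ℤ-Solver.solve-∀

2*rowContent-bound : ∀ i x M → 1 ≤ i → x ≤ M → + 2 ℤ.* rowContent i x ℤ.≤ + (M * x)
2*rowContent-bound (suc i) x M _ x≤M = begin
  + 2 ℤ.* rowContent (suc i) x        ≤⟨ ℤₚ.i≤i+j _ (+ slack) ⟩
  + 2 ℤ.* rowContent (suc i) x ℤ.+ + slack
                                      ≡⟨ cong₂ ℤ._+_ (2*rowContent (suc i) x) slack≡ ⟩
  X ℤ.* (X ℤ.- + 2 ℤ.* (+ 1 ℤ.+ I) ℤ.+ + 1) ℤ.+ (X ℤ.* D ℤ.+ X ℤ.* (+ 2 ℤ.* I) ℤ.+ X)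
                                      ≡⟨ step X D I ⟩
  (X ℤ.+ D) ℤ.* X                     ≡⟨ trans (ℤₚ.pos-* (x + d) x) (cong (ℤ._* X) (ℤₚ.pos-+ x d)) ⟨
  + ((x + d) * x)                     ≡⟨ cong (λ m → + (m * x)) (m+[n∸m]≡n x≤M) ⟩
  + (M * x)                           ∎
  where
  open ℤₚ.≤-Reasoning
  d = M ∸ x
  X = + x
  D = + d
  I = + i
  -- M x − x (x − 2 (1 + i) + 1), with M = x + d
  slack = x * d + x * (2 * i) + x
  slack≡ : + slack ≡ X ℤ.* D ℤ.+ X ℤ.* (+ 2 ℤ.* I) ℤ.+ X
  slack≡ = trans (ℤₚ.pos-+ (x * d + x * (2 * i)) x) (cong (ℤ._+ X)
             (trans (ℤₚ.pos-+ (x * d) (x * (2 * i)))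
                    (cong₂ ℤ._+_ (ℤₚ.pos-* x d) (trans (ℤₚ.pos-* x (2 * i)) (cong (X ℤ.*_) (ℤₚ.pos-* 2 i))))))
  step : ∀ X D I → X ℤ.* (X ℤ.- + 2 ℤ.* (+ 1 ℤ.+ I) ℤ.+ + 1) ℤ.+ (X ℤ.* D ℤ.+ X ℤ.* (+ 2 ℤ.* I) ℤ.+ X)
                     ≡ (X ℤ.+ D) ℤ.* X
  step = ℤ-Solver.solve-∀

2*contentFrom-bound : ∀ i L M → 1 ≤ i → All (_≤ M) L → + 2 ℤ.* contentFrom i L ℤ.≤ + (M * sum L)
2*contentFrom-bound i []      M _   []           = ℤ.+≤+ z≤n
2*contentFrom-bound i (x ∷ L) M 1≤i (x≤M ∷ L≤M) = begin
  + 2 ℤ.* (rowContent i x ℤ.+ contentFrom (suc i) L)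
    ≡⟨ ℤₚ.*-distribˡ-+ (+ 2) (rowContent i x) (contentFrom (suc i) L) ⟩
  + 2 ℤ.* rowContent i x ℤ.+ + 2 ℤ.* contentFrom (suc i) L
    ≤⟨ ℤₚ.+-mono-≤ (2*rowContent-bound i x M 1≤i x≤M) (2*contentFrom-bound (suc i) L M (s≤s z≤n) L≤M) ⟩
  + (M * x) ℤ.+ + (M * sum L)
    ≡⟨ ℤₚ.pos-+ (M * x) (M * sum L) ⟨
  + (M * x + M * sum L)
    ≡⟨ cong +_ (*-distribˡ-+ M x (sum L)) ⟨
  + (M * (x + sum L)) ∎
  where open ℤₚ.≤-Reasoning

filter-above++filter-below : ∀ (g : ℕ → ℕ) → (∀ {x y} → x ≤ y → g x ≤ g y) → ∀ t {L} → Linked _≥_ L →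
  filter (λ x → t <? g x) L ++ filter (λ x → g x ≤? t) L ≡ L
filter-above++filter-below g mono t {[]}     _  = refl
filter-above++filter-below g mono t {x ∷ xs} lk with t <? g x
... | yes t<gx = begin
  filter above (x ∷ xs) ++ filter below (x ∷ xs)
    ≡⟨ cong₂ _++_ (filter-accept above t<gx) (filter-reject below (<⇒≱ t<gx)) ⟩
  x ∷ (filter above xs ++ filter below xs)
    ≡⟨ cong (x ∷_) (filter-above++filter-below g mono t (Linked.tail lk)) ⟩
  x ∷ xs ∎
  where
  open ≡-Reasoning
  above = λ x → t <? g x
  below = λ x → g x ≤? t
... | no  t≮gx = cong₂ _++_ (filter-none (λ x → t <? g x) (All.map ≤⇒≯ all-below))
                            (filter-all (λ x → g x ≤? t) all-below)
  where
  all-below : All (λ y → g y ≤ t) (x ∷ xs)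
  all-below = All.map (λ y≤x → ≤-trans (mono y≤x) (≮⇒≥ t≮gx)) (≤first lk)

part-i : ∀ {n λs} A B → λs ≡ A ++ B → n ≡ sum A + sum B → IsShape λs →
  let P = product (map (λ x → (x !) ^ 2) A)
      m = sum A
  in f λs ^ 2 * (P * ((n ∸ m) !) ^ 2) ≤ (n !) * f B ^ 2 * (n !)
   × (n !) * f B ^ 2 * (P * (n ∸ m) !) ≤ (n !) * (P * ((n ∸ m) !) ^ 2)
   × (n !) * P ≤ n ^ m * (P * (n ∸ m) !)
part-i A B refl refl s rewrite m+n∸m≡n (sum A) (sum B) | product-map-^2 _! A =
    (begin
      F ^ 2 * (Q ^ 2 * r ^ 2)   ≡⟨ cong (F ^ 2 *_) (^-distribʳ-* Q r 2) ⟨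
      F ^ 2 * (Q * r) ^ 2       ≡⟨ ^-distribʳ-* F (Q * r) 2 ⟨
      (F * (Q * r)) ^ 2         ≤⟨ ^-monoˡ-≤ 2 multinomial ⟩
      (N * G) ^ 2               ≡⟨ ^-distribʳ-* N G 2 ⟩
      N ^ 2 * G ^ 2             ≡⟨ cong (_* G ^ 2) (x^2≡x*x N) ⟩
      N * N * G ^ 2             ≡⟨ *-assoc N N (G ^ 2) ⟩
      N * (N * G ^ 2)           ≡⟨ *-comm N (N * G ^ 2) ⟩
      N * G ^ 2 * N             ∎)
  , (begin
      N * G ^ 2 * (Q ^ 2 * r)   ≤⟨ *-monoˡ-≤ (Q ^ 2 * r) (*-monoʳ-≤ N G²≤r) ⟩
      N * r * (Q ^ 2 * r)       ≡⟨ regroup N r (Q ^ 2) ⟩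
      N * (Q ^ 2 * (r * r))     ≡⟨ cong (λ r² → N * (Q ^ 2 * r²)) (x^2≡x*x r) ⟨
      N * (Q ^ 2 * r ^ 2)       ∎)
  , (begin
      N * Q ^ 2                 ≤⟨ *-monoˡ-≤ (Q ^ 2) ([m+s]!≤[m+s]^m*s! (sum A) (sum B)) ⟩
      n ^ sum A * r * Q ^ 2     ≡⟨ *-assoc (n ^ sum A) r (Q ^ 2) ⟩
      n ^ sum A * (r * Q ^ 2)   ≡⟨ cong (n ^ sum A *_) (*-comm r (Q ^ 2)) ⟩
      n ^ sum A * (Q ^ 2 * r)   ∎)
  where
  open ≤-Reasoning
  n = sum A + sum B
  N = n !
  F = f (A ++ B)
  G = f B
  Q = product (map _! A)
  r = sum B !
  multinomial : F * (Q * r) ≤ N * G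
  multinomial = subst (λ k → F * (Q * r) ≤ k ! * G) (sum-++ A B) (f-++-≤ A B s)
  G²≤r : G ^ 2 ≤ r
  G²≤r = subst (_≤ r) (sym (x^2≡x*x G)) (sytChains²≤! (sum B) B (IsShape-++ʳ A s))
  regroup : ∀ N r X → N * r * (X * r) ≡ N * (X * (r * r))
  regroup = solve-∀

lemma3p1 : (n : ℕ) (λs : List ℕ) → IsPartition n λs →
  let L⁺ = λ⁺ n λs
      L⁻ = λ⁻ n λs
      p = length L⁺
      P = product (map (λ x → (x !) ^ 2) L⁺)
      m = ∣ L⁺ ∣ₚ
  in
  -- (i), each fraction inequality a/b ≤ c/d written as a * d ≤ c * b
  (f λs ^ 2 * (P * ((n ∸ m) !) ^ 2) ≤ (n !) * f L⁻ ^ 2 * (n !)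
    × (n !) * f L⁻ ^ 2 * (P * (n ∸ m) !) ≤ (n !) * (P * ((n ∸ m) !) ^ 2)
    × (n !) * P ≤ n ^ m * (P * (n ∸ m) !))
  -- (ii)  C_λ ≤ λ₁ n / 2
  × (+ 2 ℤ.* C λs ℤ.≤ + (first λs * n))
  -- (iii)
  × (C λs ≡ C L⁺ ℤ.- + (p * ∣ L⁻ ∣ₚ) ℤ.+ C L⁻)
  × (C L⁺ ℤ.- + (p * ∣ L⁻ ∣ₚ) ℤ.+ C L⁻
      ≡ Σℤ (zipWith (λ i x → (+ x ℤ.* (+ x ℤ.- + (2 * i) ℤ.+ + 1)) ℤ./ + 2)
                    (applyUpTo suc p) L⁺)
        ℤ.- + (p * ∣ L⁻ ∣ₚ) ℤ.+ C L⁻)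
lemma3p1 n λs record { decreasing = decreasing ; positive = positive ; size = size } =
    part-i L⁺ L⁻ λs≡L⁺++L⁻ n≡∣L⁺∣+∣L⁻∣ (Linked⇒IsShape decreasing positive)
  , subst (λ k → + 2 ℤ.* C λs ℤ.≤ + (first λs * k)) size
          (2*contentFrom-bound 1 λs (first λs) (s≤s z≤n) (≤first decreasing))
  , trans (cong C λs≡L⁺++L⁻) (C-++ L⁺ L⁻)
  , cong (λ c → c ℤ.- + (length L⁺ * sum L⁻) ℤ.+ C L⁻) (contentFrom≡ΣrowContentFormula suc 1 L⁺ (λ _ → refl))
  where
  L⁺ = λ⁺ n λs
  L⁻ = λ⁻ n λs
  λs≡L⁺++L⁻ : λs ≡ L⁺ ++ L⁻
  λs≡L⁺++L⁻ = sym (filter-above++filter-below (_^ 100) (^-monoˡ-≤ 100) (n ^ 99) decreasing)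
  n≡∣L⁺∣+∣L⁻∣ : n ≡ sum L⁺ + sum L⁻
  n≡∣L⁺∣+∣L⁻∣ = trans (sym size) (trans (cong sum λs≡L⁺++L⁻) (sum-++ L⁺ L⁻))
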